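{- Let $n\ge2$ and let $(V,\langle-,\ldots,-\rangle_n)$ be an infinite dimensional non-degenerate alternating (respectively, symmetric) $n$-linear space over a field $K$, and let $U$ be a finite dimensional subspace of $V$. Then for any linearly independent $t_1,\ldots,t_m\in\lozenge^{n-1}V$ and any $k_1,\ldots,k_m\in K$ there is $w\in V$, linearly independent from $U$, such that $\langle t_i,w\rangle_2=k_i$ for all $i\in\{1,\ldots,m\}$.
   Context: Write $\lozenge^{n-1}V$ for the exterior power $\bigwedge^{n-1}V$ (quotient of $\bigotimes^{n-1}V$ by the span of pure tensors with linearly dependent factors) in the alternating case, and for the symmetric power $\bigvee^{n-1}V$ (quotient of $\bigotimes^{n-1}V$ by the span of all $v_1\otimes\cdots\otimes v_{n-1}-v_{\sigma(1)}\otimes\cdots\otimes v_{\sigma(n-1)}$) in the symmetric case. Let $\langle-,-\rangle_2:\lozenge^{n-1}V\times V\to K$ be $\langle\overline{\sum_ik_i(v_{i,1}\otimes\cdots\otimes v_{i,n-1})},v\rangle_2=\sum_ik_i\langle v_{i,1},\ldots,v_{i,n-1},v\rangle_n$. The form is non-degenerate if for every non-zero $t\in\lozenge^{n-1}V$ there is $w$ with $\langle t,w\rangle_2\ne 0$. "Linearly independent from $U$" means $w\notin U$. -}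

module Defs where

open import Level using (_⊔_; Lift)
open import Data.Nat using (ℕ; zero; suc; _∸_)
open import Data.Fin using (Fin; zero; suc)
open import Data.Fin.Permutation using (Permutation′; _⟨$⟩ʳ_)
open import Data.Vec.Functional using (updateAt)
open import Data.Product using (Σ; ∃; _×_; _,_)
open import Data.List using (List; []; _∷_; _++_; map; foldr)
open import Data.List.Relation.Binary.Permutation.Propositional using (_↭_)
open import Relation.Nullary using (¬_)
open import Relation.Binary.PropositionalEquality using (_≡_)
open import Algebra.Bundles using (CommutativeRing)
open import Algebra.Module.Bundles using (Module)

record IsField {c ℓ} (K : CommutativeRing c ℓ) : Set (c ⊔ ℓ) where
  open CommutativeRing K
  field
    0≉1     : ¬ (0# ≈ 1#)
    inverse : ∀ x → ¬ (x ≈ 0#) → ∃ λ y → x * y ≈ 1#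

-- alternating case (◊ = exterior power) / symmetric case (◊ = symmetric power)
data Kind : Set where
  alternating symmetric : Kind

module _ {c ℓ m ℓm} (K : CommutativeRing c ℓ) (V : Module K m ℓm) where
  open CommutativeRing K using (Carrier; _≈_; _+_; _*_; 0#)
  open Module V using (Carrierᴹ; _≈ᴹ_; _+ᴹ_; _*ₗ_; 0ᴹ)

  lc : ∀ {d} → (Fin d → Carrier) → (Fin d → Carrierᴹ) → Carrierᴹ
  lc {zero}  c u = 0ᴹ
  lc {suc d} c u = (c zero *ₗ u zero) +ᴹ lc (λ i → c (suc i)) (λ i → u (suc i))

  InSpan : ∀ {d} → (Fin d → Carrierᴹ) → Carrierᴹ → Set (c ⊔ ℓm)
  InSpan u v = ∃ λ a → v ≈ᴹ lc a u

  LinDep : ∀ {d} → (Fin d → Carrierᴹ) → Set (c ⊔ ℓ ⊔ ℓm)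
  LinDep u = ∃ λ a → (∃ λ i → ¬ (a i ≈ 0#)) × (lc a u ≈ᴹ 0ᴹ)

  -- V is infinite dimensional: no finite family spans V
  -- (positive form: every finite family misses some vector)
  InfiniteDimensional : Set (m ⊔ c ⊔ ℓm)
  InfiniteDimensional = ∀ d (u : Fin d → Carrierᴹ) → ∃ λ v → ¬ InSpan u v

  record IsMultilinear (n : ℕ) (f : (Fin n → Carrierᴹ) → Carrier)
         : Set (c ⊔ ℓ ⊔ m ⊔ ℓm) where
    field
      cong        : ∀ x y → (∀ i → x i ≈ᴹ y i) → f x ≈ f y
      additive    : ∀ x i a b →
        f (updateAt x i (λ _ → a +ᴹ b))
          ≈ f (updateAt x i (λ _ → a)) + f (updateAt x i (λ _ → b))
      homogeneous : ∀ x i k a →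
        f (updateAt x i (λ _ → k *ₗ a)) ≈ k * f (updateAt x i (λ _ → a))

  IsAlternating : (n : ℕ) → ((Fin n → Carrierᴹ) → Carrier) → Set (ℓ ⊔ m ⊔ ℓm)
  IsAlternating n f = ∀ x (i j : Fin n) → ¬ (i ≡ j) → x i ≈ᴹ x j → f x ≈ 0#

  IsSymmetric : (n : ℕ) → ((Fin n → Carrierᴹ) → Carrier) → Set (ℓ ⊔ m)
  IsSymmetric n f = ∀ x (σ : Permutation′ n) → f (λ i → x (σ ⟨$⟩ʳ i)) ≈ f x

  HasKind : Kind → (n : ℕ) → ((Fin n → Carrierᴹ) → Carrier) → Set (ℓ ⊔ m ⊔ ℓm)
  HasKind alternating n f = IsAlternating n f
  HasKind symmetric   n f = Lift ℓm (IsSymmetric n f)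

  -- ◊^p V, presented as formal K-linear combinations of p-tuples of
  -- vectors, modulo the congruence generated by: the free-module relations,
  -- multilinearity (giving ⊗^p V), and the alternating (pure tensors with
  -- linearly dependent factors are 0) resp. symmetric relations.

  FSum : ℕ → Set (c ⊔ m)
  FSum p = List (Carrier × (Fin p → Carrierᴹ))

  scale : ∀ {p} → Carrier → FSum p → FSum p
  scale k = map (λ { (a , x) → (k * a , x) })

  pure : ∀ {p} → Carrier → (Fin p → Carrierᴹ) → FSum p
  pure a x = (a , x) ∷ []

  data Equiv (κ : Kind) {p : ℕ} : FSum p → FSum p → Set (c ⊔ ℓ ⊔ m ⊔ ℓm) where
    ≡-refl   : ∀ {s} → Equiv κ s s
    ≡-sym    : ∀ {s t} → Equiv κ s t → Equiv κ t s
    ≡-trans  : ∀ {s t u} → Equiv κ s t → Equiv κ t u → Equiv κ s u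
    perm     : ∀ {s t} → s ↭ t → Equiv κ s t
    ++-cong  : ∀ {s s′ t t′} → Equiv κ s s′ → Equiv κ t t′ → Equiv κ (s ++ t) (s′ ++ t′)
    scale-cong : ∀ k {s t} → Equiv κ s t → Equiv κ (scale k s) (scale k t)
    entry-cong : ∀ a a′ x x′ → a ≈ a′ → (∀ i → x i ≈ᴹ x′ i) →
                 Equiv κ (pure a x) (pure a′ x′)
    merge    : ∀ a b x → Equiv κ ((a , x) ∷ (b , x) ∷ []) (pure (a + b) x)
    zero-coeff : ∀ x → Equiv κ (pure 0# x) []
    slot-add : ∀ k x i a b →
      Equiv κ (pure k (updateAt x i (λ _ → a +ᴹ b)))
              ((k , updateAt x i (λ _ → a)) ∷ (k , updateAt x i (λ _ → b)) ∷ [])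
    slot-scal : ∀ k x i e a →
      Equiv κ (pure k (updateAt x i (λ _ → e *ₗ a)))
              (pure (k * e) (updateAt x i (λ _ → a)))
    alt-rel  : κ ≡ alternating → ∀ k x → LinDep x → Equiv κ (pure k x) []
    sym-rel  : κ ≡ symmetric → ∀ k x (σ : Permutation′ p) →
      Equiv κ (pure k x) (pure k (λ i → x (σ ⟨$⟩ʳ i)))

  IsZero◊ : Kind → ∀ {p} → FSum p → Set (c ⊔ ℓ ⊔ m ⊔ ℓm)
  IsZero◊ κ t = Equiv κ t []

  combine : ∀ {p d} → (Fin d → Carrier) → (Fin d → FSum p) → FSum p
  combine {d = zero}  a t = []
  combine {d = suc d} a t = scale (a zero) (t zero) ++ combine (λ i → a (suc i)) (λ i → t (suc i))

  LinIndep◊ : Kind → ∀ {p d} → (Fin d → FSum p) → Set (c ⊔ ℓ ⊔ m ⊔ ℓm)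
  LinIndep◊ κ t = ∀ a → IsZero◊ κ (combine a t) → ∀ i → a i ≈ 0#

  extend : ∀ {n} → (Fin (n ∸ 1) → Carrierᴹ) → Carrierᴹ → Fin n → Carrierᴹ
  extend {suc zero}    x w zero    = w
  extend {suc (suc p)} x w zero    = x zero
  extend {suc (suc p)} x w (suc j) = extend {suc p} (λ i → x (suc i)) w j

  pairing₂ : ∀ {n} → ((Fin n → Carrierᴹ) → Carrier) → FSum (n ∸ 1) → Carrierᴹ → Carrier
  pairing₂ {n} f t w = foldr (λ { (k , x) acc → k * f (extend {n} x w) + acc }) 0# t

  NonDegenerate : Kind → (n : ℕ) → ((Fin n → Carrierᴹ) → Carrier) → Set (c ⊔ ℓ ⊔ m ⊔ ℓm)
  NonDegenerate κ n f =
    ∀ (t : FSum (n ∸ 1)) → ¬ IsZero◊ κ t → ∃ λ w → ¬ (pairing₂ {n} f t w ≈ 0#)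

{-# OPTIONS --safe #-}
module Submission where

-- The pairings φᵢ = ⟨tᵢ, -⟩₂ are linear functionals on V, by multilinearity of the form in its
-- last slot, and non-degeneracy turns linear independence of the tᵢ into linear independence
-- of the φᵢ. Over a field, independent functionals φ₁, …, φᵣ admit a dual family w₁, …, wᵣ
-- (φⱼ wᵢ = δᵢⱼ), built by induction on r. As V is infinite dimensional there is v outside the
-- span of U and the wᵢ; then w = v + Σᵢ (kᵢ − φᵢ v) wᵢ takes the prescribed values and still
-- lies outside U.

open import Defs
open import Level using (_⊔_)
open import Data.Nat using (ℕ; zero; suc; _∸_; _≤_; s≤s)
open import Data.Fin using (Fin; zero; suc; splitAt; fromℕ)
import Data.List as List
open import Data.Product using (∃; Σ; _×_; _,_; proj₁; proj₂)
open import Data.Sum.Properties using ([,]-map)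
open import Data.Vec.Functional using (Vector; _∷_; tail; _++_; updateAt)
open import Function using (_∘_)
open import Relation.Nullary using (¬_)
open import Relation.Binary.PropositionalEquality as ≡ using (_≡_; _≗_)
open import Algebra.Bundles using (CommutativeRing; CommutativeMonoid; Ring; Semiring)
open import Algebra.Module.Bundles using (Module)
open import Algebra.Module.Morphism.Structures using (module LeftSemimoduleMorphisms)
import Algebra.Module.Construct.TensorUnit as TensorUnit
import Algebra.Definitions.RawMonoid as RawMonoidDefinitions
import Algebra.Properties.CommutativeSemigroup as CommutativeSemigroupProperties
import Algebra.Properties.Group as GroupProperties
import Algebra.Properties.Monoid.Sum as MonoidSumProperties
import Algebra.Properties.RingWithoutOne as RingWithoutOneProperties
import Relation.Binary.Reasoning.Setoid as SetoidReasoning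

module LinearFunctionals {c ℓ m ℓm} (K : CommutativeRing c ℓ) (V : Module K m ℓm) where

  open CommutativeRing K hiding (zero)
  open Module V using (Carrierᴹ; _≈ᴹ_; _+ᴹ_; _*ₗ_; 0ᴹ; ≈ᴹ-sym; ≈ᴹ-setoid;
    +ᴹ-cong; +ᴹ-congˡ; +ᴹ-congʳ; *ₗ-congʳ; +ᴹ-assoc; +ᴹ-identityˡ; +ᴹ-identityʳ; +ᴹ-commutativeMonoid;
    *ₗ-zeroˡ; *ₗ-distribʳ; rawLeftSemimodule)
  open RawMonoidDefinitions +-rawMonoid using (sum)
  open MonoidSumProperties +-monoid using (sum-cong-≋; sum-replicate-zero)
  open GroupProperties +-group using (\\-leftDividesˡ)
  open RingWithoutOneProperties (Ring.ringWithoutOne ring) using (-‿distribˡ-*)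
  open LeftSemimoduleMorphisms rawLeftSemimodule (TensorUnit.rawLeftSemimodule {R = Semiring.rawSemiring semiring})
    using (IsLeftSemimoduleHomomorphism)
  module +ᴹ = CommutativeSemigroupProperties (CommutativeMonoid.commutativeSemigroup +ᴹ-commutativeMonoid)
  module + = CommutativeSemigroupProperties +-commutativeSemigroup
  module * = CommutativeSemigroupProperties *-commutativeSemigroup

  IsLinearFunctional : (Carrierᴹ → Carrier) → Set (c ⊔ ℓ ⊔ m ⊔ ℓm)
  IsLinearFunctional = IsLeftSemimoduleHomomorphism

  isLinearFunctional : ∀ {φ : Carrierᴹ → Carrier} →
    (∀ {a b} → a ≈ᴹ b → φ a ≈ φ b) →
    (∀ a b → φ (a +ᴹ b) ≈ φ a + φ b) →
    (∀ k a → φ (k *ₗ a) ≈ k * φ a) →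
    IsLinearFunctional φ
  isLinearFunctional {φ} φ-cong +-homo *ₗ-homo = record
    { +ᴹ-isMonoidHomomorphism = record
      { isMagmaHomomorphism = record
        { isRelHomomorphism = record { cong = φ-cong }
        ; homo = +-homo
        }
      ; ε-homo = begin
          φ 0ᴹ           ≈⟨ φ-cong (≈ᴹ-sym (*ₗ-zeroˡ 0ᴹ)) ⟩
          φ (0# *ₗ 0ᴹ)   ≈⟨ *ₗ-homo 0# 0ᴹ ⟩
          0# * φ 0ᴹ      ≈⟨ zeroˡ (φ 0ᴹ) ⟩
          0#             ∎
      }
    ; *ₗ-homo = *ₗ-homo
    }
    where open SetoidReasoning setoid

  module _ {φ ψ : Carrierᴹ → Carrier} (φ-linear : IsLinearFunctional φ) (ψ-linear : IsLinearFunctional ψ) where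
    open IsLeftSemimoduleHomomorphism φ-linear renaming (⟦⟧-cong to φ-cong; +ᴹ-homo to φ-+; *ₗ-homo to φ-*ₗ)
    open IsLeftSemimoduleHomomorphism ψ-linear renaming (⟦⟧-cong to ψ-cong; +ᴹ-homo to ψ-+; *ₗ-homo to ψ-*ₗ)

    +-isLinearFunctional : IsLinearFunctional (λ w → φ w + ψ w)
    +-isLinearFunctional = isLinearFunctional
      (λ a≈b → +-cong (φ-cong a≈b) (ψ-cong a≈b))
      (λ a b → trans (+-cong (φ-+ a b) (ψ-+ a b)) (+.interchange _ _ _ _))
      (λ k a → trans (+-cong (φ-*ₗ k a) (ψ-*ₗ k a)) (sym (distribˡ k _ _)))

  0-isLinearFunctional : IsLinearFunctional (λ _ → 0#)
  0-isLinearFunctional = isLinearFunctional (λ _ → refl) (λ _ _ → sym (+-identityʳ 0#)) (λ k _ → sym (zeroʳ k))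

  *-isLinearFunctional : ∀ k {φ} → IsLinearFunctional φ → IsLinearFunctional (λ w → k * φ w)
  *-isLinearFunctional k φ-linear = isLinearFunctional
    (λ a≈b → *-congˡ (⟦⟧-cong a≈b))
    (λ a b → trans (*-congˡ (+ᴹ-homo a b)) (distribˡ k _ _))
    (λ e a → trans (*-congˡ (*ₗ-homo e a)) (*.x∙yz≈y∙xz k e _))
    where open IsLeftSemimoduleHomomorphism φ-linear

  lc-cong-≗ : ∀ {d} {a b : Fin d → Carrier} {u v : Fin d → Carrierᴹ} → a ≗ b → u ≗ v → lc K V a u ≡ lc K V b v
  lc-cong-≗ {zero}  a≗b u≗v = ≡.refl
  lc-cong-≗ {suc d} a≗b u≗v = ≡.cong₂ _+ᴹ_ (≡.cong₂ _*ₗ_ (a≗b zero) (u≗v zero)) (lc-cong-≗ (a≗b ∘ suc) (u≗v ∘ suc))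

  tail-++ : ∀ {a} {A : Set a} {d r} (xs : Vector A (suc d)) (ys : Vector A r) → tail (xs ++ ys) ≗ tail xs ++ ys
  tail-++ {d = d} xs ys i = [,]-map (splitAt d i)

  lc-++ : ∀ {d r} (a : Fin d → Carrier) (b : Fin r → Carrier) u W →
    lc K V (a ++ b) (u ++ W) ≈ᴹ lc K V a u +ᴹ lc K V b W
  lc-++ {zero}  a b u W = ≈ᴹ-sym (+ᴹ-identityˡ _)
  lc-++ {suc d} a b u W = begin
    a zero *ₗ u zero +ᴹ lc K V (tail (a ++ b)) (tail (u ++ W))
      ≡⟨ ≡.cong (a zero *ₗ u zero +ᴹ_) (lc-cong-≗ (tail-++ a b) (tail-++ u W)) ⟩
    a zero *ₗ u zero +ᴹ lc K V (tail a ++ b) (tail u ++ W)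
      ≈⟨ +ᴹ-congˡ (lc-++ (tail a) b (tail u) W) ⟩
    a zero *ₗ u zero +ᴹ (lc K V (tail a) (tail u) +ᴹ lc K V b W)
      ≈⟨ ≈ᴹ-sym (+ᴹ-assoc _ _ _) ⟩
    lc K V a u +ᴹ lc K V b W ∎
    where open SetoidReasoning ≈ᴹ-setoid

  lc-cancel : ∀ {r} (a : Fin r → Carrier) W → lc K V a W +ᴹ lc K V (λ i → - a i) W ≈ᴹ 0ᴹ
  lc-cancel {zero}  a W = +ᴹ-identityˡ 0ᴹ
  lc-cancel {suc r} a W = begin
    (a zero *ₗ W zero +ᴹ lc K V (tail a) (tail W)) +ᴹ ((- a zero) *ₗ W zero +ᴹ lc K V (λ i → - a (suc i)) (tail W))
      ≈⟨ +ᴹ.interchange _ _ _ _ ⟩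
    (a zero *ₗ W zero +ᴹ (- a zero) *ₗ W zero) +ᴹ (lc K V (tail a) (tail W) +ᴹ lc K V (λ i → - a (suc i)) (tail W))
      ≈⟨ +ᴹ-cong (≈ᴹ-sym (*ₗ-distribʳ _ _ _)) (lc-cancel (tail a) (tail W)) ⟩
    (a zero - a zero) *ₗ W zero +ᴹ 0ᴹ
      ≈⟨ +ᴹ-identityʳ _ ⟩
    (a zero - a zero) *ₗ W zero
      ≈⟨ *ₗ-congʳ (-‿inverseʳ _) ⟩
    0# *ₗ W zero
      ≈⟨ *ₗ-zeroˡ _ ⟩
    0ᴹ ∎
    where open SetoidReasoning ≈ᴹ-setoid

  ∉-span-shift : ∀ {d r} (u : Fin d → Carrierᴹ) (W : Fin r → Carrierᴹ) {v} →
    ¬ InSpan K V (u ++ W) v → ∀ e → ¬ InSpan K V u (v +ᴹ lc K V e W)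
  ∉-span-shift u W {v} v∉ e (a , w≈) = v∉ (a ++ (λ i → - e i) , (begin
    v                                                    ≈⟨ ≈ᴹ-sym (+ᴹ-identityʳ v) ⟩
    v +ᴹ 0ᴹ                                              ≈⟨ +ᴹ-congˡ (≈ᴹ-sym (lc-cancel e W)) ⟩
    v +ᴹ (lc K V e W +ᴹ lc K V (λ i → - e i) W)          ≈⟨ ≈ᴹ-sym (+ᴹ-assoc _ _ _) ⟩
    (v +ᴹ lc K V e W) +ᴹ lc K V (λ i → - e i) W          ≈⟨ +ᴹ-congʳ w≈ ⟩
    lc K V a u +ᴹ lc K V (λ i → - e i) W                 ≈⟨ ≈ᴹ-sym (lc-++ a _ u W) ⟩
    lc K V (a ++ (λ i → - e i)) (u ++ W)                 ∎))
    where open SetoidReasoning ≈ᴹ-setoid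

  lc-homo : ∀ {φ} → IsLinearFunctional φ → ∀ {d} (a : Fin d → Carrier) u →
    φ (lc K V a u) ≈ sum (λ i → a i * φ (u i))
  lc-homo φ-linear {zero}  a u = 0ᴹ-homo
    where open IsLeftSemimoduleHomomorphism φ-linear
  lc-homo {φ} φ-linear {suc d} a u = begin
    φ (a zero *ₗ u zero +ᴹ lc K V (tail a) (tail u))       ≈⟨ +ᴹ-homo _ _ ⟩
    φ (a zero *ₗ u zero) + φ (lc K V (tail a) (tail u))    ≈⟨ +-cong (*ₗ-homo _ _) (lc-homo φ-linear (tail a) (tail u)) ⟩
    a zero * φ (u zero) + sum (λ i → a (suc i) * φ (u (suc i))) ∎
    where open IsLeftSemimoduleHomomorphism φ-linear
          open SetoidReasoning setoid

  δ : ∀ {r} → Fin r → Fin r → Carrier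
  δ zero    zero    = 1#
  δ zero    (suc j) = 0#
  δ (suc i) zero    = 0#
  δ (suc i) (suc j) = δ i j

  sum-*-δ : ∀ {r} (e : Fin r → Carrier) j → sum (λ i → e i * δ i j) ≈ e j
  sum-*-δ {suc r} e zero = begin
    e zero * 1# + sum (λ i → e (suc i) * 0#)  ≈⟨ +-cong (*-identityʳ _) (sum-cong-≋ (λ i → zeroʳ (e (suc i)))) ⟩
    e zero + sum {r} (λ _ → 0#)               ≈⟨ +-congˡ (sum-replicate-zero r) ⟩
    e zero + 0#                               ≈⟨ +-identityʳ _ ⟩
    e zero                                    ∎
    where open SetoidReasoning setoid
  sum-*-δ {suc r} e (suc j) = begin
    e zero * 0# + sum (λ i → e (suc i) * δ i j)  ≈⟨ +-cong (zeroʳ _) (sum-*-δ (tail e) j) ⟩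
    0# + e (suc j)                               ≈⟨ +-identityˡ _ ⟩
    e (suc j)                                    ∎
    where open SetoidReasoning setoid

  IsDualFamily : ∀ {r} → (Fin r → Carrierᴹ → Carrier) → (Fin r → Carrierᴹ) → Set ℓ
  IsDualFamily φ W = ∀ i j → φ j (W i) ≈ δ i j

  -- Linear independence in the constructive form supplied by non-degeneracy: a combination
  -- with a non-zero coefficient comes with a vector on which it does not vanish.
  Independent : ∀ {r} → (Fin r → Carrierᴹ → Carrier) → Set (c ⊔ ℓ ⊔ m)
  Independent {r} φ = ∀ (a : Fin r → Carrier) i → ¬ a i ≈ 0# → ∃ λ v → ¬ sum (λ j → a j * φ j v) ≈ 0#

  dual-shift : ∀ {r} {φ : Fin r → Carrierᴹ → Carrier} → (∀ i → IsLinearFunctional (φ i)) →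
    ∀ {W} → IsDualFamily φ W → ∀ v e j → φ j (v +ᴹ lc K V e W) ≈ φ j v + e j
  dual-shift {φ = φ} φ-linear {W} dual v e j = begin
    φ j (v +ᴹ lc K V e W)                 ≈⟨ +ᴹ-homo v _ ⟩
    φ j v + φ j (lc K V e W)              ≈⟨ +-congˡ (lc-homo (φ-linear j) e W) ⟩
    φ j v + sum (λ i → e i * φ j (W i))   ≈⟨ +-congˡ (sum-cong-≋ (λ i → *-congˡ (dual i j))) ⟩
    φ j v + sum (λ i → e i * δ i j)       ≈⟨ +-congˡ (sum-*-δ e j) ⟩
    φ j v + e j                           ∎
    where open IsLeftSemimoduleHomomorphism (φ-linear j)
          open SetoidReasoning setoid

  Independent-tail : ∀ {r} {φ : Fin (suc r) → Carrierᴹ → Carrier} → Independent φ → Independent (tail φ)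
  Independent-tail ind a i aᵢ≉0 =
    let v , combination≉0 = ind (0# ∷ a) (suc i) aᵢ≉0
    in v , λ tail≈0 → combination≉0 (trans (+-cong (zeroˡ _) tail≈0) (+-identityʳ 0#))

  dualFamily-cons : ∀ {r} {φ : Fin (suc r) → Carrierᴹ → Carrier} → (∀ i → IsLinearFunctional (φ i)) →
    ∀ {W w} → IsDualFamily (tail φ) W → φ zero w ≈ 1# → (∀ j → φ (suc j) w ≈ 0#) →
    IsDualFamily φ (w ∷ λ i → W i +ᴹ (- φ zero (W i)) *ₗ w)
  dualFamily-cons _ _ φ₀w≈1 _     zero zero    = φ₀w≈1
  dualFamily-cons _ _ _     φₛw≈0 zero (suc j) = φₛw≈0 j
  dualFamily-cons {φ = φ} φ-linear {W} {w} dual φ₀w≈1 φₛw≈0 (suc i) j =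
    trans (φ-of-corrected j) (corrected-value j)
    where
    μ : Carrier
    μ = - φ zero (W i)

    φ-of-corrected : ∀ j → φ j (W i +ᴹ μ *ₗ w) ≈ φ j (W i) + μ * φ j w
    φ-of-corrected j = trans (+ᴹ-homo _ _) (+-congˡ (*ₗ-homo μ w))
      where open IsLeftSemimoduleHomomorphism (φ-linear j)

    corrected-value : ∀ j → φ j (W i) + μ * φ j w ≈ δ (suc i) j
    corrected-value zero    = trans (+-congˡ (trans (*-congˡ φ₀w≈1) (*-identityʳ μ))) (-‿inverseʳ _)
    corrected-value (suc j) = trans (+-cong (dual i j) (trans (*-congˡ (φₛw≈0 j)) (zeroʳ μ))) (+-identityʳ _)

  -x*y≈-y*x : ∀ x y → - x * y ≈ - y * x
  -x*y≈-y*x x y = trans (sym (-‿distribˡ-* x y)) (trans (-‿cong (*-comm x y)) (-‿distribˡ-* y x))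

  headDual : IsField K → ∀ {r} {φ : Fin (suc r) → Carrierᴹ → Carrier} →
    (∀ i → IsLinearFunctional (φ i)) → Independent φ → ∀ {W} → IsDualFamily (tail φ) W →
    ∃ λ w → φ zero w ≈ 1# × (∀ j → φ (suc j) w ≈ 0#)
  headDual isField {r} {φ} φ-linear ind {W} dual = y *ₗ w′ , φ₀-scaled , φₛ-scaled
    where
    open IsField isField
    open IsLeftSemimoduleHomomorphism using (+ᴹ-homo; *ₗ-homo)
    open SetoidReasoning setoid

    a : Fin (suc r) → Carrier
    a = 1# ∷ λ i → - φ zero (W i)

    witness : ∃ λ v → ¬ sum (λ j → a j * φ j v) ≈ 0#
    witness = ind a zero (0≉1 ∘ sym)

    v : Carrierᴹ
    v = proj₁ witness

    -- Removing the components of v along W kills φ (suc j) but leaves the combination a in φ zero.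
    w′ : Carrierᴹ
    w′ = v +ᴹ lc K V (λ i → - φ (suc i) v) W

    φₛw′≈0 : ∀ j → φ (suc j) w′ ≈ 0#
    φₛw′≈0 j = trans (dual-shift (φ-linear ∘ suc) dual v _ j) (-‿inverseʳ _)

    φ₀w′≈combination : φ zero w′ ≈ sum (λ j → a j * φ j v)
    φ₀w′≈combination = begin
      φ zero w′
        ≈⟨ +ᴹ-homo (φ-linear zero) _ _ ⟩
      φ zero v + φ zero (lc K V (λ i → - φ (suc i) v) W)
        ≈⟨ +-cong (sym (*-identityˡ _)) (lc-homo (φ-linear zero) _ W) ⟩
      1# * φ zero v + sum (λ i → - φ (suc i) v * φ zero (W i))
        ≈⟨ +-congˡ (sum-cong-≋ (λ i → -x*y≈-y*x (φ (suc i) v) (φ zero (W i)))) ⟩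
      1# * φ zero v + sum (λ i → - φ zero (W i) * φ (suc i) v) ∎

    inv : ∃ λ y → φ zero w′ * y ≈ 1#
    inv = inverse (φ zero w′) (proj₂ witness ∘ trans (sym φ₀w′≈combination))

    y : Carrier
    y = proj₁ inv

    φ₀-scaled : φ zero (y *ₗ w′) ≈ 1#
    φ₀-scaled = trans (*ₗ-homo (φ-linear zero) y w′) (trans (*-comm y _) (proj₂ inv))

    φₛ-scaled : ∀ j → φ (suc j) (y *ₗ w′) ≈ 0#
    φₛ-scaled j = trans (*ₗ-homo (φ-linear (suc j)) y w′) (trans (*-congˡ (φₛw′≈0 j)) (zeroʳ y))

  dualFamily : IsField K → ∀ {r} {φ : Fin r → Carrierᴹ → Carrier} →
    (∀ i → IsLinearFunctional (φ i)) → Independent φ → Σ (Fin r → Carrierᴹ) (IsDualFamily φ)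
  dualFamily _ {zero} _ _ = (λ ()) , (λ ())
  dualFamily isField {suc r} {φ} φ-linear ind =
    let W , dual         = dualFamily isField {φ = tail φ} (φ-linear ∘ suc) (Independent-tail {φ = φ} ind)
        _ , φ₀w≈1 , φₛw≈0 = headDual isField φ-linear ind dual
    in _ , dualFamily-cons φ-linear dual φ₀w≈1 φₛw≈0

  ∃-∉span-with-values : IsField K → InfiniteDimensional K V →
    ∀ {r} {φ : Fin r → Carrierᴹ → Carrier} → (∀ i → IsLinearFunctional (φ i)) → Independent φ →
    ∀ {d} (u : Fin d → Carrierᴹ) (k : Fin r → Carrier) →
    ∃ λ w → ¬ InSpan K V u w × (∀ i → φ i w ≈ k i)
  ∃-∉span-with-values isField infinite {φ = φ} φ-linear ind u k =
    let W , dual = dualFamily isField φ-linear ind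
        v , v∉   = infinite _ (u ++ W)
        e i      = - φ i v + k i
    in v +ᴹ lc K V e W , ∉-span-shift u W v∉ e ,
       λ i → trans (dual-shift φ-linear dual v e i) (\\-leftDividesˡ (φ i v) (k i))

module Pairing {c ℓ m ℓm} (K : CommutativeRing c ℓ) (V : Module K m ℓm) where

  open CommutativeRing K hiding (zero)
  open Module V using (Carrierᴹ; _≈ᴹ_; _+ᴹ_; _*ₗ_; 0ᴹ; ≈ᴹ-refl; ≈ᴹ-reflexive)
  open LinearFunctionals K V
  open RawMonoidDefinitions +-rawMonoid using (sum)

  extend-updateAt : ∀ r (x : Fin r → Carrierᴹ) w →
    extend K V {suc r} x w ≗ updateAt (extend K V {suc r} x 0ᴹ) (fromℕ r) (λ _ → w)
  extend-updateAt zero    x w zero    = ≡.refl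
  extend-updateAt (suc r) x w zero    = ≡.refl
  extend-updateAt (suc r) x w (suc j) = extend-updateAt r (tail x) w j

  extend-cong : ∀ r (x : Fin r → Carrierᴹ) {a b} → a ≈ᴹ b → ∀ j → extend K V {suc r} x a j ≈ᴹ extend K V {suc r} x b j
  extend-cong zero    x a≈b zero    = a≈b
  extend-cong (suc r) x a≈b zero    = ≈ᴹ-refl
  extend-cong (suc r) x a≈b (suc j) = extend-cong r (tail x) a≈b j

  module _ {q} {f : (Fin (suc q) → Carrierᴹ) → Carrier} (f-multilinear : IsMultilinear K V (suc q) f) where
    open IsMultilinear f-multilinear renaming (cong to f-cong)

    f∘extend-isLinearFunctional : ∀ x → IsLinearFunctional (λ w → f (extend K V {suc q} x w))
    f∘extend-isLinearFunctional x = isLinearFunctional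
      (λ a≈b → f-cong _ _ (extend-cong q x a≈b))
      (λ a b → trans (as-update (a +ᴹ b)) (trans (additive x₀ (fromℕ q) a b) (sym (+-cong (as-update a) (as-update b)))))
      (λ k a → trans (as-update (k *ₗ a)) (trans (homogeneous x₀ (fromℕ q) k a) (sym (*-congˡ (as-update a)))))
      where
      x₀ : Fin (suc q) → Carrierᴹ
      x₀ = extend K V {suc q} x 0ᴹ

      as-update : ∀ w → f (extend K V {suc q} x w) ≈ f (updateAt x₀ (fromℕ q) (λ _ → w))
      as-update w = f-cong _ _ (≈ᴹ-reflexive ∘ extend-updateAt q x w)

    pairing₂-isLinearFunctional : ∀ t → IsLinearFunctional (pairing₂ K V {suc q} f t)
    pairing₂-isLinearFunctional List.[]            = 0-isLinearFunctional
    pairing₂-isLinearFunctional ((k , x) List.∷ t) =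
      +-isLinearFunctional (*-isLinearFunctional k (f∘extend-isLinearFunctional x)) (pairing₂-isLinearFunctional t)

  module _ {n} (f : (Fin n → Carrierᴹ) → Carrier) where

    pairing₂-++ : ∀ s t w → pairing₂ K V {n} f (s List.++ t) w ≈ pairing₂ K V f s w + pairing₂ K V f t w
    pairing₂-++ List.[]            t w = sym (+-identityˡ _)
    pairing₂-++ ((k , x) List.∷ s) t w = trans (+-congˡ (pairing₂-++ s t w)) (sym (+-assoc _ _ _))

    pairing₂-scale : ∀ e s w → pairing₂ K V {n} f (scale K V e s) w ≈ e * pairing₂ K V f s w
    pairing₂-scale e List.[]            w = sym (zeroʳ e)
    pairing₂-scale e ((k , x) List.∷ s) w =
      trans (+-cong (*-assoc e k _) (pairing₂-scale e s w)) (sym (distribˡ e _ _))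

    pairing₂-combine : ∀ {r} (a : Fin r → Carrier) t w →
      pairing₂ K V {n} f (combine K V a t) w ≈ sum (λ i → a i * pairing₂ K V f (t i) w)
    pairing₂-combine {zero}  a t w = refl
    pairing₂-combine {suc r} a t w =
      trans (pairing₂-++ (scale K V (a zero) (t zero)) _ w)
            (+-cong (pairing₂-scale (a zero) (t zero) w) (pairing₂-combine (tail a) (tail t) w))

    pairings-independent : ∀ {κ} → NonDegenerate K V κ n f →
      ∀ {r} {t : Fin r → FSum K V (n ∸ 1)} → LinIndep◊ K V κ t → Independent (λ i → pairing₂ K V f (t i))
    pairings-independent nondegenerate {t = t} t-independent a i aᵢ≉0 =
      let v , pairing≉0 = nondegenerate (combine K V a t) (λ zero◊ → aᵢ≉0 (t-independent a zero◊ i))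
      in v , pairing≉0 ∘ trans (pairing₂-combine a t v)

open LinearFunctionals using (∃-∉span-with-values)
open Pairing using (pairing₂-isLinearFunctional; pairings-independent)

lemma2p8 : ∀ {c ℓ m ℓm} (K : CommutativeRing c ℓ) → IsField K →
    (V : Module K m ℓm) → (n : ℕ) → 2 ≤ n → (κ : Kind) →
    (f : (Fin n → Module.Carrierᴹ V) → CommutativeRing.Carrier K) →
    IsMultilinear K V n f → HasKind K V κ n f → NonDegenerate K V κ n f →
    InfiniteDimensional K V →
    ∀ {d} (u : Fin d → Module.Carrierᴹ V) →
    ∀ {r} (t : Fin r → FSum K V (n ∸ 1)) → LinIndep◊ K V κ t →
    (k : Fin r → CommutativeRing.Carrier K) →
    ∃ λ w → (¬ InSpan K V u w) ×
      (∀ i → CommutativeRing._≈_ K (pairing₂ K V {n} f (t i) w) (k i))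
lemma2p8 K isField V .(suc _) (s≤s _) _ f f-multilinear _ nondegenerate infinite u t t-independent k =
  ∃-∉span-with-values K V isField infinite
    (λ i → pairing₂-isLinearFunctional K V f-multilinear (t i))
    (pairings-independent K V f nondegenerate t-independent)
    u k
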